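{- Let $\lambda$ be a $\mathcal P$-position of \textsc{RIT} under normal play (a losing position for the player to move). Then for every move $\lambda\to\bar\lambda$ there exists a move $\bar\lambda\to\tilde\lambda$ on an odd-numbered row of $\bar\lambda$ such that $\tilde\lambda$ is again a $\mathcal P$-position. Furthermore, if the move $\lambda\to\bar\lambda$ reduces the even-numbered row $i$ by some amount $k$, then reducing row $i-1$ of $\bar\lambda$ by the same amount $k$ is a legal move leading to a $\mathcal P$-position.
   Context: An \textsc{RIT} (Row Impartial Terminus) position is a partition $\lambda=(\lambda_1,\dots,\lambda_r)$, written as a nonincreasing tuple of nonnegative integers (a move keeps the length $r$ of the tuple, zero entries being allowed; the empty partition is the unique terminal position). For $k\in[1,\lambda_1]$, there is a move from $\lambda$ to $\bar\lambda$ where $\bar\lambda_i=k-1$ for $i$ the largest index with $\lambda_i\ge k$, and $\bar\lambda_j=\lambda_j$ for $j\ne i$; this is a move on the $i$th row, reducing it by $\lambda_i-k+1$. Informally, a move shortens one row of the Young diagram so that the result is still a Young diagram. Under normal play the terminal position is a $\mathcal P$-position; a position is an $\mathcal N$-position iff some move leads to a $\mathcal P$-position, and a $\mathcal P$-position otherwise. -}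

module Defs where

open import Data.Nat using (ℕ; zero; suc; _≤_; _<_; _∸_; _%_)
open import Data.Fin using (Fin; toℕ) renaming (_<_ to _<ᶠ_)
open import Data.Vec using (Vec; lookup; _[_]≔_)
open import Data.Product using (Σ; _×_)
open import Relation.Binary.PropositionalEquality using (_≡_)

-- A position with r rows: a tuple (λ₁,…,λᵣ) of naturals (zeros allowed).
-- Row numbers are 1-based in the paper; the Fin index i stands for row (toℕ i + 1).
Position : ℕ → Set
Position r = Vec ℕ r

IsPartition : ∀ {r} → Position r → Set
IsPartition {r} λ′ = ∀ (i j : Fin r) → i <ᶠ j → lookup λ′ j ≤ lookup λ′ i

-- Move λ i λ̄ : the move of the paper with parameter k ∈ [1, λ₁],
-- where i is the largest index with λ_i ≥ k, replacing λ_i by k - 1.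
-- (k ≤ λ₁ follows from k ≤ λ_i for a partition.)
data Move {r : ℕ} (λ′ : Position r) (i : Fin r) : Position r → Set where
  move : (k : ℕ) → 1 ≤ k → k ≤ lookup λ′ i
       → (∀ (j : Fin r) → i <ᶠ j → lookup λ′ j < k)
       → Move λ′ i (λ′ [ i ]≔ (k ∸ 1))

-- Normal-play outcome classes, defined inductively (the game is finite,
-- so this coincides with the usual recursive definition).
mutual
  data IsP {r : ℕ} (λ′ : Position r) : Set where
    isP : (∀ (i : Fin r) (λ̄ : Position r) → Move λ′ i λ̄ → IsN λ̄) → IsP λ′

  data IsN {r : ℕ} (λ′ : Position r) : Set where
    isN : (i : Fin r) (λ̄ : Position r) → Move λ′ i λ̄ → IsP λ̄ → IsN λ′

-- Row with Fin index i has paper number toℕ i + 1; it is odd-numbered iff toℕ i is even.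
OddRow : ∀ {r} → Fin r → Set
OddRow i = toℕ i % 2 ≡ 0

EvenRow : ∀ {r} → Fin r → Set
EvenRow i = toℕ i % 2 ≡ 1

{-# OPTIONS --safe #-}

-- RIT is staircase Nim. Pair row 2k−1 with row 2k and read the gap λ_{2k−1} − λ_{2k} as a Nim pile
-- (an unpaired last row is a pile by itself). A move on an odd row lowers one pile, exactly as in Nim;
-- a move on an even row raises one pile. As in Bouton's theorem, λ is a P-position iff the nim-sum of
-- the piles is 0: every move changes the nim-sum, and from a nonzero nim-sum Bouton's move, which lowers
-- a pile and is therefore a move on an odd row, reaches nim-sum 0. Finally, if row 2k is lowered by some
-- amount, lowering row 2k−1 by the same amount restores their pile and hence the nim-sum 0.

module Submission where

open import Defs
open import Algebra.Bundles using (AbelianGroup)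
open import Algebra.Structures using (IsAbelianGroup)
import Algebra.Properties.AbelianGroup as AbelianGroupProperties
import Algebra.Properties.CommutativeSemigroup as CommutativeSemigroupProperties
open import Data.Fin using (Fin; toℕ; zero; suc)
open import Data.Fin.Properties using () renaming (_≟_ to _≟ᶠ_)
open import Data.List using (List; []; _∷_; map; foldr)
open import Data.List.Relation.Unary.Any as Any using (Any; here; there)
open import Data.List.Relation.Unary.Any.Properties using (map⁻)
open import Data.Nat using (ℕ; zero; suc; _+_; _*_; _∸_; _≤_; _<_; z≤n; s≤s; z<s; ⌊_/2⌋; parity)
open import Data.Nat.Induction using (<-rec; <-wellFounded)
open import Data.Nat.Properties
open import Data.Parity.Base as ℙ using (Parity; 0ℙ; 1ℙ)
import Data.Parity.Properties as ℙ
open import Data.Product using (Σ; _×_; _,_)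
open import Data.Vec using (Vec; []; _∷_; lookup; _[_]≔_; sum)
open import Data.Vec.Properties using (lookup∘update; lookup∘update′)
open import Function.Base using (id)
open import Induction.WellFounded using (Acc; acc)
open import Level using (0ℓ)
open import Relation.Binary.PropositionalEquality
open import Relation.Nullary using (¬_; yes; no; contradiction)
open import Relation.Nullary.Decidable using (decidable-stable)

bit : Parity → ℕ
bit 0ℙ = 0
bit 1ℙ = 1

bit+2*suc : ∀ p n → bit p + 2 * suc n ≡ 2 + (bit p + 2 * n)
bit+2*suc 0ℙ n = *-suc 2 n
bit+2*suc 1ℙ n = cong suc (*-suc 2 n)

parity[bit+2*n] : ∀ p n → parity (bit p + 2 * n) ≡ p
parity[bit+2*n] p n = begin
  parity (bit p + 2 * n)            ≡⟨ ℙ.+-homo-+ (bit p) (2 * n) ⟩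
  parity (bit p) ℙ.+ parity (2 * n) ≡⟨ cong (ℙ._+ _) (parity-bit p) ⟩
  p ℙ.+ parity (2 * n)              ≡⟨ cong (p ℙ.+_) (ℙ.*-homo-* 2 n) ⟩
  p ℙ.+ 0ℙ                          ≡⟨ ℙ.+-identityʳ p ⟩
  p                                 ∎
  where
  open ≡-Reasoning
  parity-bit : ∀ p → parity (bit p) ≡ p
  parity-bit 0ℙ = refl
  parity-bit 1ℙ = refl

⌊bit+2*n/2⌋≡n : ∀ p n → ⌊ bit p + 2 * n /2⌋ ≡ n
⌊bit+2*n/2⌋≡n 0ℙ zero = refl
⌊bit+2*n/2⌋≡n 1ℙ zero = refl
⌊bit+2*n/2⌋≡n p (suc n) = trans (cong ⌊_/2⌋ (bit+2*suc p n)) (cong suc (⌊bit+2*n/2⌋≡n p n))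

n≡bit+2*⌊n/2⌋ : ∀ n → n ≡ bit (parity n) + 2 * ⌊ n /2⌋
n≡bit+2*⌊n/2⌋ 0 = refl
n≡bit+2*⌊n/2⌋ 1 = refl
n≡bit+2*⌊n/2⌋ (suc (suc n)) =
  trans (cong (2 +_) (n≡bit+2*⌊n/2⌋ n)) (sym (bit+2*suc (parity n) ⌊ n /2⌋))

binary-ext : ∀ {m n} → parity m ≡ parity n → ⌊ m /2⌋ ≡ ⌊ n /2⌋ → m ≡ n
binary-ext {m} {n} p h = begin
  m                            ≡⟨ n≡bit+2*⌊n/2⌋ m ⟩
  bit (parity m) + 2 * ⌊ m /2⌋ ≡⟨ cong₂ (λ q k → bit q + 2 * k) p h ⟩
  bit (parity n) + 2 * ⌊ n /2⌋ ≡⟨ n≡bit+2*⌊n/2⌋ n ⟨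
  n                            ∎
  where open ≡-Reasoning

nimSum : ∀ m → Acc _<_ m → ℕ → ℕ
nimSum zero        _         n = n
nimSum m@(suc m-1) (acc rec) n =
  bit (parity m ℙ.+ parity n) + 2 * nimSum ⌊ m /2⌋ (rec (⌊n/2⌋<n m-1)) ⌊ n /2⌋

nimSum-acc-irrelevant : ∀ m {acc₁ acc₂} n → nimSum m acc₁ n ≡ nimSum m acc₂ n
nimSum-acc-irrelevant zero n = refl
nimSum-acc-irrelevant m@(suc _) {acc _} {acc _} n =
  cong (λ k → bit (parity m ℙ.+ parity n) + 2 * k) (nimSum-acc-irrelevant ⌊ m /2⌋ ⌊ n /2⌋)

infixl 6 _⊕_
_⊕_ : ℕ → ℕ → ℕ
m ⊕ n = nimSum m (<-wellFounded m) n

⊕-unfold : ∀ m n → m ⊕ n ≡ bit (parity m ℙ.+ parity n) + 2 * (⌊ m /2⌋ ⊕ ⌊ n /2⌋)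
⊕-unfold zero    n = n≡bit+2*⌊n/2⌋ n
⊕-unfold m@(suc _) n with <-wellFounded m
... | acc _ = cong (λ k → bit (parity m ℙ.+ parity n) + 2 * k) (nimSum-acc-irrelevant ⌊ m /2⌋ ⌊ n /2⌋)

parity-⊕ : ∀ m n → parity (m ⊕ n) ≡ parity m ℙ.+ parity n
parity-⊕ m n =
  trans (cong parity (⊕-unfold m n)) (parity[bit+2*n] (parity m ℙ.+ parity n) (⌊ m /2⌋ ⊕ ⌊ n /2⌋))

⌊⊕/2⌋ : ∀ m n → ⌊ m ⊕ n /2⌋ ≡ ⌊ m /2⌋ ⊕ ⌊ n /2⌋
⌊⊕/2⌋ m n =
  trans (cong ⌊_/2⌋ (⊕-unfold m n)) (⌊bit+2*n/2⌋≡n (parity m ℙ.+ parity n) (⌊ m /2⌋ ⊕ ⌊ n /2⌋))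

⊕-identityˡ : ∀ n → 0 ⊕ n ≡ n
⊕-identityˡ n = refl

⊕-identityʳ : ∀ m → m ⊕ 0 ≡ m
⊕-identityʳ = <-rec _ λ where
  zero        _   → refl
  m@(suc m-1) rec → binary-ext
    (trans (parity-⊕ m 0) (ℙ.+-identityʳ (parity m)))
    (trans (⌊⊕/2⌋ m 0) (rec (⌊n/2⌋<n m-1)))

⊕-comm : ∀ m n → m ⊕ n ≡ n ⊕ m
⊕-comm = <-rec _ λ where
  zero        _   n → sym (⊕-identityʳ n)
  m@(suc m-1) rec n → binary-ext
    (trans (parity-⊕ m n) (trans (ℙ.+-comm (parity m) (parity n)) (sym (parity-⊕ n m))))
    (trans (⌊⊕/2⌋ m n) (trans (rec (⌊n/2⌋<n m-1) ⌊ n /2⌋) (sym (⌊⊕/2⌋ n m))))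

⊕-assoc : ∀ m n o → (m ⊕ n) ⊕ o ≡ m ⊕ (n ⊕ o)
⊕-assoc = <-rec _ (λ where
  zero        _   n o → refl
  m@(suc m-1) rec n o → binary-ext
    (begin
      parity ((m ⊕ n) ⊕ o)                 ≡⟨ parity-⊕ (m ⊕ n) o ⟩
      parity (m ⊕ n) ℙ.+ parity o          ≡⟨ cong (ℙ._+ parity o) (parity-⊕ m n) ⟩
      parity m ℙ.+ parity n ℙ.+ parity o   ≡⟨ ℙ.+-assoc (parity m) (parity n) (parity o) ⟩
      parity m ℙ.+ (parity n ℙ.+ parity o) ≡⟨ cong (parity m ℙ.+_) (parity-⊕ n o) ⟨
      parity m ℙ.+ parity (n ⊕ o)          ≡⟨ parity-⊕ m (n ⊕ o) ⟨
      parity (m ⊕ (n ⊕ o))                 ∎)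
    (begin
      ⌊ (m ⊕ n) ⊕ o /2⌋                     ≡⟨ ⌊⊕/2⌋ (m ⊕ n) o ⟩
      ⌊ m ⊕ n /2⌋ ⊕ ⌊ o /2⌋                 ≡⟨ cong (_⊕ ⌊ o /2⌋) (⌊⊕/2⌋ m n) ⟩
      (⌊ m /2⌋ ⊕ ⌊ n /2⌋) ⊕ ⌊ o /2⌋         ≡⟨ rec (⌊n/2⌋<n m-1) ⌊ n /2⌋ ⌊ o /2⌋ ⟩
      ⌊ m /2⌋ ⊕ (⌊ n /2⌋ ⊕ ⌊ o /2⌋)         ≡⟨ cong (⌊ m /2⌋ ⊕_) (⌊⊕/2⌋ n o) ⟨
      ⌊ m /2⌋ ⊕ ⌊ n ⊕ o /2⌋                 ≡⟨ ⌊⊕/2⌋ m (n ⊕ o) ⟨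
      ⌊ m ⊕ (n ⊕ o) /2⌋                     ∎))
  where open ≡-Reasoning

⊕-self : ∀ m → m ⊕ m ≡ 0
⊕-self = <-rec _ λ where
  zero        _   → refl
  m@(suc m-1) rec → binary-ext
    (trans (parity-⊕ m m) (ℙ.p+p≡0ℙ (parity m)))
    (trans (⌊⊕/2⌋ m m) (rec (⌊n/2⌋<n m-1)))

⊕-0-isAbelianGroup : IsAbelianGroup _≡_ _⊕_ 0 id
⊕-0-isAbelianGroup = record
  { isGroup = record
    { isMonoid = record
      { isSemigroup = record
        { isMagma = record { isEquivalence = isEquivalence ; ∙-cong = cong₂ _⊕_ }
        ; assoc   = ⊕-assoc
        }
      ; identity = ⊕-identityˡ , ⊕-identityʳ
      }
    ; inverse = ⊕-self , ⊕-self
    ; ⁻¹-cong = id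
    }
  ; comm = ⊕-comm
  }

⊕-0-abelianGroup : AbelianGroup 0ℓ 0ℓ
⊕-0-abelianGroup = record { isAbelianGroup = ⊕-0-isAbelianGroup }

⊕-cancelˡ : ∀ c m n → c ⊕ m ≡ c ⊕ n → m ≡ n
⊕-cancelˡ = AbelianGroupProperties.∙-cancelˡ ⊕-0-abelianGroup

⊕-cancelʳ : ∀ c m n → m ⊕ c ≡ n ⊕ c → m ≡ n
⊕-cancelʳ = AbelianGroupProperties.∙-cancelʳ ⊕-0-abelianGroup

⊕-exchangeˡ : ∀ m n o → m ⊕ (n ⊕ o) ≡ n ⊕ (m ⊕ o)
⊕-exchangeˡ = CommutativeSemigroupProperties.x∙yz≈y∙xz (AbelianGroup.commutativeSemigroup ⊕-0-abelianGroup)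

⊕-exchangeʳ : ∀ m n o → (m ⊕ n) ⊕ o ≡ n ⊕ (m ⊕ o)
⊕-exchangeʳ = CommutativeSemigroupProperties.xy∙z≈y∙xz (AbelianGroup.commutativeSemigroup ⊕-0-abelianGroup)

⨁ : List ℕ → ℕ
⨁ = foldr _⊕_ 0

⌊⨁/2⌋ : ∀ xs → ⌊ ⨁ xs /2⌋ ≡ ⨁ (map ⌊_/2⌋ xs)
⌊⨁/2⌋ []       = refl
⌊⨁/2⌋ (x ∷ xs) = trans (⌊⊕/2⌋ x (⨁ xs)) (cong (⌊ x /2⌋ ⊕_) (⌊⨁/2⌋ xs))

odd-⨁⇒odd-member : ∀ xs → parity (⨁ xs) ≡ 1ℙ → Any (λ x → parity x ≡ 1ℙ) xs
odd-⨁⇒odd-member (x ∷ xs) odd with parity x in px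
... | 1ℙ = here px
... | 0ℙ = there (odd-⨁⇒odd-member xs (begin
  parity (⨁ xs)              ≡⟨ cong (ℙ._+ parity (⨁ xs)) px ⟨
  parity x ℙ.+ parity (⨁ xs) ≡⟨ parity-⊕ x (⨁ xs) ⟨
  parity (x ⊕ ⨁ xs)          ≡⟨ odd ⟩
  1ℙ                         ∎))
  where open ≡-Reasoning

odd⇒⊕1< : ∀ {a} → parity a ≡ 1ℙ → a ⊕ 1 < a
odd⇒⊕1< {a} odd = begin-strict
  a ⊕ 1                                     ≡⟨ ⊕-unfold a 1 ⟩
  bit (parity a ℙ.+ 1ℙ) + 2 * (⌊ a /2⌋ ⊕ 0) ≡⟨ cong₂ (λ p k → bit (p ℙ.+ 1ℙ) + 2 * k) odd (⊕-identityʳ ⌊ a /2⌋) ⟩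
  2 * ⌊ a /2⌋                               <⟨ n<1+n (2 * ⌊ a /2⌋) ⟩
  bit 1ℙ + 2 * ⌊ a /2⌋                      ≡⟨ cong (λ p → bit p + 2 * ⌊ a /2⌋) odd ⟨
  bit (parity a) + 2 * ⌊ a /2⌋              ≡⟨ n≡bit+2*⌊n/2⌋ a ⟨
  a                                         ∎
  where open ≤-Reasoning

⌊/2⌋-⊕-<⇒⊕-< : ∀ a s → ⌊ a /2⌋ ⊕ ⌊ s /2⌋ < ⌊ a /2⌋ → a ⊕ s < a
⌊/2⌋-⊕-<⇒⊕-< a s lt = begin-strict
  a ⊕ s                                        ≡⟨ ⊕-unfold a s ⟩
  bit (parity a ℙ.+ parity s) + 2 * h          ≤⟨ +-monoˡ-≤ (2 * h) (bit≤1 (parity a ℙ.+ parity s)) ⟩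
  1 + 2 * h                                    <⟨ n<1+n (1 + 2 * h) ⟩
  2 + 2 * h                                    ≡⟨ *-suc 2 h ⟨
  2 * suc h                                    ≤⟨ *-monoʳ-≤ 2 lt ⟩
  2 * ⌊ a /2⌋                                  ≤⟨ m≤n+m (2 * ⌊ a /2⌋) (bit (parity a)) ⟩
  bit (parity a) + 2 * ⌊ a /2⌋                 ≡⟨ n≡bit+2*⌊n/2⌋ a ⟨
  a                                            ∎
  where
  open ≤-Reasoning
  h : ℕ
  h = ⌊ a /2⌋ ⊕ ⌊ s /2⌋
  bit≤1 : ∀ p → bit p ≤ 1
  bit≤1 0ℙ = z≤n
  bit≤1 1ℙ = ≤-refl

-- Halve every pile until the nim-sum is 1; then any odd pile, lowered by one, works.
⨁≢0⇒winning-pile : ∀ xs → ⨁ xs ≢ 0 → Any (λ x → x ⊕ ⨁ xs < x) xs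
⨁≢0⇒winning-pile xs = <-rec P step (⨁ xs) xs refl
  where
  P : ℕ → Set
  P s = ∀ xs → ⨁ xs ≡ s → s ≢ 0 → Any (λ x → x ⊕ s < x) xs
  step : ∀ s → (∀ {t} → t < s → P t) → P s
  step 0 _ _ _ s≢0 = contradiction refl s≢0
  step 1 _ xs ⨁≡1 _ = Any.map odd⇒⊕1< (odd-⨁⇒odd-member xs (cong parity ⨁≡1))
  step s@(suc s-1@(suc _)) rec xs ⨁≡s _ =
    Any.map (λ {x} → ⌊/2⌋-⊕-<⇒⊕-< x s)
      (map⁻ (rec (⌊n/2⌋<n s-1) (map ⌊_/2⌋ xs) (trans (sym (⌊⨁/2⌋ xs)) (cong ⌊_/2⌋ ⨁≡s)) λ ()))

sum-[]≔-< : ∀ {n x} (v : Vec ℕ n) i → x < lookup v i → sum (v [ i ]≔ x) < sum v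
sum-[]≔-< (a ∷ v) zero    x<a  = +-monoˡ-< (sum v) x<a
sum-[]≔-< (a ∷ v) (suc i) x<vᵢ = +-monoʳ-< a (sum-[]≔-< v i x<vᵢ)

piles : ∀ {r} → Position r → List ℕ
piles []          = []
piles (a ∷ [])    = a ∷ []
piles (a ∷ b ∷ v) = a ∸ b ∷ piles v

nimValue : ∀ {r} → Position r → ℕ
nimValue v = ⨁ (piles v)

module _ {r : ℕ} where

  IsPartition-tail : ∀ {a} {v : Position r} → IsPartition (a ∷ v) → IsPartition v
  IsPartition-tail p i j i<j = p (suc i) (suc j) (s≤s i<j)

  IsPartition-head : ∀ {a} {v : Position r} → IsPartition (a ∷ v) → ∀ j → lookup (a ∷ v) j ≤ a
  IsPartition-head p zero    = ≤-refl
  IsPartition-head p (suc j) = p zero (suc j) z<s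

  Move-first-row : ∀ {a m} {v : Position r} → (∀ j → lookup v j ≤ m) → m < a → Move (a ∷ v) zero (m ∷ v)
  Move-first-row {m = m} v≤m m<a = move (suc m) (s≤s z≤n) m<a λ where
    (suc j) _ → s≤s (v≤m j)

  Move-shift₂ : ∀ {a b} {v w : Position r} {i} → Move v i w → Move (a ∷ b ∷ v) (suc (suc i)) (a ∷ b ∷ w)
  Move-shift₂ (move k 1≤k k≤vᵢ below) = move k 1≤k k≤vᵢ λ where
    (suc (suc j)) (s≤s (s≤s i<j)) → below j i<j

  Move-unshift₂ : ∀ {a b} {v w : Position r} {i} → Move (a ∷ b ∷ v) (suc (suc i)) (a ∷ b ∷ w) → Move v i w
  Move-unshift₂ (move k 1≤k k≤vᵢ below) = move k 1≤k k≤vᵢ λ j i<j → below (suc (suc j)) (s≤s (s≤s i<j))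

  Move⇒sum-< : ∀ {v w : Position r} {i} → Move v i w → sum w < sum v
  Move⇒sum-< {v} {i = i} (move (suc m) _ m<vᵢ _) = sum-[]≔-< v i m<vᵢ

  Move-preserves-IsPartition : ∀ {v w : Position r} {i} → Move v i w → IsPartition v → IsPartition w
  Move-preserves-IsPartition {v} {i = i} (move (suc m) _ m<vᵢ below) p x y x<y with x ≟ᶠ i | y ≟ᶠ i
  ... | yes refl | yes refl = contradiction x<y (<-irrefl refl)
  ... | yes refl | no y≢i  = subst₂ _≤_ (sym (lookup∘update′ y≢i v m)) (sym (lookup∘update x v m))
                               (≤-pred (below y x<y))
  ... | no x≢i  | yes refl = subst₂ _≤_ (sym (lookup∘update y v m)) (sym (lookup∘update′ x≢i v m))
                               (≤-trans (n≤1+n m) (≤-trans m<vᵢ (p x y x<y)))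
  ... | no x≢i  | no y≢i   = subst₂ _≤_ (sym (lookup∘update′ y≢i v m)) (sym (lookup∘update′ x≢i v m))
                               (p x y x<y)

Move⇒nimValue≢ : ∀ {r} {v w : Position r} {i} → IsPartition v → Move v i w → nimValue w ≢ nimValue v
Move⇒nimValue≢ {v = a ∷ []} {i = zero} _ (move (suc m) _ m<a _) eq = <-irrefl (⊕-cancelʳ 0 m a eq) m<a
Move⇒nimValue≢ {v = a ∷ b ∷ v} {i = zero} _ (move (suc m) _ m<a below) eq =
  <-irrefl (∸-cancelʳ-≡ b≤m (≤-trans b≤m (<⇒≤ m<a)) (⊕-cancelʳ (nimValue v) (m ∸ b) (a ∸ b) eq)) m<a
  where
  b≤m : b ≤ m
  b≤m = ≤-pred (below (suc zero) z<s)
Move⇒nimValue≢ {v = a ∷ b ∷ v} {i = suc zero} p (move (suc m) _ m<b _) eq =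
  <-irrefl (∸-cancelˡ-≡ (≤-trans (<⇒≤ m<b) b≤a) b≤a (⊕-cancelʳ (nimValue v) (a ∸ m) (a ∸ b) eq)) m<b
  where
  b≤a : b ≤ a
  b≤a = IsPartition-head p (suc zero)
Move⇒nimValue≢ {v = a ∷ b ∷ v} {i = suc (suc i)} p v→w@(move _ _ _ _) eq =
  Move⇒nimValue≢ (IsPartition-tail (IsPartition-tail p)) (Move-unshift₂ v→w) (⊕-cancelˡ (a ∸ b) _ _ eq)

winning-move : ∀ {r} {v : Position r} {s} → IsPartition v → Any (λ d → d ⊕ s < d) (piles v)
  → Σ (Fin r) λ j → Σ (Position r) λ w → OddRow j × Move v j w × nimValue w ≡ s ⊕ nimValue v
winning-move {v = a ∷ []} {s} _ (here lt) =
  zero , a ⊕ s ∷ [] , refl , Move-first-row (λ ()) lt , ⊕-exchangeʳ a s 0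
winning-move {v = a ∷ b ∷ v} {s} p (here lt) =
  zero , b + d ∷ b ∷ v , refl , Move-first-row rows≤ b+d<a , nimValue-eq
  where
  d : ℕ
  d = (a ∸ b) ⊕ s
  b≤a : b ≤ a
  b≤a = IsPartition-head p (suc zero)
  rows≤ : ∀ j → lookup (b ∷ v) j ≤ b + d
  rows≤ j = ≤-trans (IsPartition-head (IsPartition-tail p) j) (m≤m+n b d)
  b+d<a : b + d < a
  b+d<a = subst (b + d <_) (m+[n∸m]≡n b≤a) (+-monoʳ-< b lt)
  nimValue-eq : (b + d ∸ b) ⊕ nimValue v ≡ s ⊕ ((a ∸ b) ⊕ nimValue v)
  nimValue-eq = trans (cong (_⊕ nimValue v) (m+n∸m≡n b d)) (⊕-exchangeʳ (a ∸ b) s (nimValue v))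
winning-move {v = a ∷ b ∷ v} {s} p (there q) with winning-move (IsPartition-tail (IsPartition-tail p)) q
... | j , w , odd , v→w , eq = suc (suc j) , a ∷ b ∷ w , odd , Move-shift₂ v→w ,
                               trans (cong ((a ∸ b) ⊕_) eq) (⊕-exchangeˡ (a ∸ b) s (nimValue v))

mirror-move : ∀ {r} {v w : Position r} {i j} → IsPartition v → EvenRow i → toℕ i ≡ suc (toℕ j) → Move v i w
  → let w′ = w [ j ]≔ (lookup w j ∸ (lookup v i ∸ lookup w i)) in Move w j w′ × nimValue w′ ≡ nimValue v
mirror-move {v = a ∷ b ∷ v} {i = suc zero} {zero} p _ _ v→w@(move (suc m) _ m<b _) =
  Move-first-row rows≤ a∸[b∸m]<a , cong (_⊕ nimValue v) a∸[b∸m]∸m≡a∸b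
  where
  b≤a : b ≤ a
  b≤a = IsPartition-head p (suc zero)
  m≤b : m ≤ b
  m≤b = <⇒≤ m<b
  m≤a∸[b∸m] : m ≤ a ∸ (b ∸ m)
  m≤a∸[b∸m] = m+n≤o⇒m≤o∸n m (subst (_≤ a) (sym (m+[n∸m]≡n m≤b)) b≤a)
  rows≤ : ∀ j → lookup (m ∷ v) j ≤ a ∸ (b ∸ m)
  rows≤ j = ≤-trans (IsPartition-head (IsPartition-tail (Move-preserves-IsPartition v→w p)) j) m≤a∸[b∸m]
  a∸[b∸m]<a : a ∸ (b ∸ m) < a
  a∸[b∸m]<a = ∸-monoʳ-< (m<n⇒0<n∸m m<b) (≤-trans (m∸n≤m b m) b≤a)
  a∸[b∸m]∸m≡a∸b : a ∸ (b ∸ m) ∸ m ≡ a ∸ b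
  a∸[b∸m]∸m≡a∸b = trans (∸-+-assoc a (b ∸ m) m) (cong (a ∸_) (m∸n+n≡m m≤b))
mirror-move {v = a ∷ b ∷ v} {i = suc (suc i)} {suc (suc j)} p even i≡1+j v→w@(move _ _ _ _)
  with mirror-move (IsPartition-tail (IsPartition-tail p)) even (suc-injective (suc-injective i≡1+j))
                   (Move-unshift₂ v→w)
... | w→w′ , eq = Move-shift₂ w→w′ , cong ((a ∸ b) ⊕_) eq
mirror-move {i = zero}                          _ _    ()  _
mirror-move {i = suc zero}          {suc _}     _ _    ()  _
mirror-move {i = suc (suc _)}       {zero}      _ _    ()  _
mirror-move {i = suc (suc zero)}    {suc zero}  _ ()   _   _
mirror-move {i = suc (suc (suc _))} {suc zero}  _ _    ()  _

module _ {r : ℕ} where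

  IsP⇒¬IsN : {v : Position r} → IsP v → ¬ IsN v
  IsP⇒¬IsN (isP allN) (isN i w v→w Pw) = IsP⇒¬IsN Pw (allN i w v→w)

  nimValue≢0⇒odd-move-to-0 : {v : Position r} → IsPartition v → nimValue v ≢ 0
    → Σ (Fin r) λ j → Σ (Position r) λ u → OddRow j × Move v j u × nimValue u ≡ 0
  nimValue≢0⇒odd-move-to-0 {v} p v≢0 with winning-move p (⨁≢0⇒winning-pile (piles v) v≢0)
  ... | j , u , odd , v→u , eq = j , u , odd , v→u , trans eq (⊕-self (nimValue v))

  Move⇒nimValue≢0 : {v w : Position r} {i : Fin r}
    → IsPartition v → nimValue v ≡ 0 → Move v i w → nimValue w ≢ 0
  Move⇒nimValue≢0 p v≡0 v→w w≡0 = Move⇒nimValue≢ p v→w (trans w≡0 (sym v≡0))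

  nimValue≡0⇒IsP : {v : Position r} → IsPartition v → nimValue v ≡ 0 → IsP v
  nimValue≡0⇒IsP {v} = go v (<-wellFounded (sum v))
    where
    go : ∀ v → Acc _<_ (sum v) → IsPartition v → nimValue v ≡ 0 → IsP v
    go v (acc smaller) p v≡0 = isP λ i w v→w →
      let pw                      = Move-preserves-IsPartition v→w p
          (j , u , _ , w→u , u≡0) = nimValue≢0⇒odd-move-to-0 pw (Move⇒nimValue≢0 p v≡0 v→w)
          u<v                     = <-trans (Move⇒sum-< w→u) (Move⇒sum-< v→w)
      in isN j u w→u (go u (smaller u<v) (Move-preserves-IsPartition w→u pw) u≡0)

  nimValue≢0⇒odd-move-to-P : {v : Position r} → IsPartition v → nimValue v ≢ 0
    → Σ (Fin r) λ j → Σ (Position r) λ u → OddRow j × Move v j u × IsP u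
  nimValue≢0⇒odd-move-to-P p v≢0 with nimValue≢0⇒odd-move-to-0 p v≢0
  ... | j , u , odd , v→u , u≡0 = j , u , odd , v→u , nimValue≡0⇒IsP (Move-preserves-IsPartition v→u p) u≡0

  IsP⇒nimValue≡0 : {v : Position r} → IsPartition v → IsP v → nimValue v ≡ 0
  IsP⇒nimValue≡0 {v} p Pv = decidable-stable (nimValue v ≟ 0) λ v≢0 →
    let (j , u , _ , v→u , Pu) = nimValue≢0⇒odd-move-to-P p v≢0 in IsP⇒¬IsN Pv (isN j u v→u Pu)

corollary3p4 : ∀ {r : ℕ} (λ′ : Position r) → IsPartition λ′ → IsP λ′
    → (∀ (i : Fin r) (λ̄ : Position r) → Move λ′ i λ̄
        → Σ (Fin r) (λ j → Σ (Position r) (λ λ̃ → OddRow j × Move λ̄ j λ̃ × IsP λ̃)))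
      × (∀ (i j : Fin r) (λ̄ : Position r) → EvenRow i → toℕ i ≡ suc (toℕ j) → Move λ′ i λ̄
          → Move λ̄ j (λ̄ [ j ]≔ (lookup λ̄ j ∸ (lookup λ′ i ∸ lookup λ̄ i)))
            × IsP (λ̄ [ j ]≔ (lookup λ̄ j ∸ (lookup λ′ i ∸ lookup λ̄ i))))
corollary3p4 λ′ p Pλ =
    (λ i λ̄ λ→λ̄ →
       nimValue≢0⇒odd-move-to-P (Move-preserves-IsPartition λ→λ̄ p) (Move⇒nimValue≢0 p λ≡0 λ→λ̄))
  , (λ i j λ̄ even i≡1+j λ→λ̄ →
       let (λ̄→λ̃ , λ̃≡λ) = mirror-move p even i≡1+j λ→λ̄
           pλ̃            = Move-preserves-IsPartition λ̄→λ̃ (Move-preserves-IsPartition λ→λ̄ p)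
       in λ̄→λ̃ , nimValue≡0⇒IsP pλ̃ (trans λ̃≡λ λ≡0))
  where
  λ≡0 : nimValue λ′ ≡ 0
  λ≡0 = IsP⇒nimValue≡0 p Pλ
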